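{- Let $\{W_1,\ldots,W_f\}$ be a set of mutually quasi-unbiased weighing matrices for parameters $(d,2,4,1)$. Then $f\leq d-1$.
   Context: A weighing matrix of order $d$ and weight $k$ is a $d\times d$ matrix $W$ with entries in $\{0,\pm1\}$ with $WW^T=kI$. Two weighing matrices $W_1,W_2$ of order $d$ and weight $k$ are quasi-unbiased for parameters $(d,k,l,a)$ if $\frac{1}{\sqrt a}W_1W_2^T$ is a weighing matrix of weight $l$. A set is mutually quasi-unbiased for $(d,k,l,a)$ if any two distinct members are quasi-unbiased for $(d,k,l,a)$. -}

module Defs where

open import Data.Nat using (ℕ; zero; suc)
import Data.Fin as F
open import Data.Fin using (Fin; _≟_)
open import Relation.Nullary using (yes; no)
open import Data.Integer using (ℤ; +_; -[1+_]; _*_; _+_; 0ℤ; 1ℤ; -1ℤ)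
open import Data.Sum using (_⊎_)
open import Data.Product using (_×_)
open import Relation.Binary.PropositionalEquality using (_≡_)

Matrix : ℕ → Set
Matrix d = Fin d → Fin d → ℤ

∑ : ∀ {n} → (Fin n → ℤ) → ℤ
∑ {zero} f = 0ℤ
∑ {suc n} f = f F.zero + ∑ (λ i → f (F.suc i))

transpose : ∀ {d} → Matrix d → Matrix d
transpose A i j = A j i

_·_ : ∀ {d} → Matrix d → Matrix d → Matrix d
(A · B) i j = ∑ (λ l → A i l * B l j)

scalarI : ∀ {d} → ℤ → Matrix d
scalarI {d} k i j with i ≟ j
... | yes _ = k
... | no _ = 0ℤ

Trit : ℤ → Set
Trit x = (x ≡ 0ℤ) ⊎ ((x ≡ 1ℤ) ⊎ (x ≡ -1ℤ))

IsWeighing : (d k : ℕ) → Matrix d → Set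
IsWeighing d k W = (∀ i j → Trit (W i j)) × (∀ i j → (W · transpose W) i j ≡ scalarI (+ k) i j)

-- quasi-unbiased for parameters (d,k,l,1): (1/√1) W₁ W₂ᵀ = W₁ W₂ᵀ is a weighing matrix of weight l
-- (both W₁, W₂ are assumed weighing matrices of order d and weight k)
QuasiUnbiased₁ : (d k l : ℕ) → Matrix d → Matrix d → Set
QuasiUnbiased₁ d k l W₁ W₂ =
  IsWeighing d k W₁ × IsWeighing d k W₂ × IsWeighing d l (W₁ · transpose W₂)

-- Let W be a weighing matrix of order d = n + 1 and weight 2.  Its columns are
-- nonzero (the Gram matrix G = Wᵀ W satisfies G² = 2 G, which bounds every
-- column norm by 2, and the column norms add up to the row norms 2d), so some
-- row r has W r 0 = ±1; as row r has squared norm 2 it has exactly one further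
-- nonzero entry, in some column suc x.  Such a row is "anchored at x".
-- Choosing an anchor for each Wᵢ gives a map Fin f → Fin n, which is injective:
-- if a row of Wᵢ and a row of Wⱼ are both anchored at x, orthogonality of the
-- rows of Wⱼ forces |Wⱼ t 0| = |Wⱼ t (suc x)| for every t, so each entry of the
-- anchored row of Wᵢ Wⱼᵀ has the form ±u ± v with |u| = |v| and is even; lying
-- in {0,±1} it vanishes, so Wᵢ Wⱼᵀ has a zero row and is not a weighing matrix
-- of weight 4.
module Submission where

open import Defs
open import Data.Nat as ℕ using (ℕ; zero; suc; _≤_; _∸_)
open import Data.Fin using (Fin; zero; suc; _≟_; punchIn)
import Data.Fin.Properties as Finₚ
import Data.Nat.Properties as ℕₚ
open import Data.Integer as ℤ using (ℤ; +_; _+_; _*_; -_; 0ℤ; 1ℤ; -1ℤ; ∣_∣; +≤+)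
import Data.Integer.Properties as ℤₚ
open import Data.Integer.Tactic.RingSolver using (solve-∀)
open import Algebra.Properties.Semiring.Sum ℤₚ.+-*-semiring
  using (sum; sum-remove) renaming (∑-comm to sum-comm)
open import Algebra.Properties.AbelianGroup ℤₚ.+-0-abelianGroup using (∙-cancelˡ; inverseˡ-unique)
open import Data.Empty using (⊥; ⊥-elim)
open import Data.Product using (_×_; _,_; proj₁; proj₂; ∃; ∃₂)
open import Data.Sum using (_⊎_; inj₁; inj₂; [_,_]′)
open import Function using (_∘_; id; Injective)
open import Relation.Nullary using (yes; no)
open import Relation.Nullary.Decidable using (decidable-stable)
open import Relation.Binary.PropositionalEquality

∑≡sum : ∀ {n} (f : Fin n → ℤ) → ∑ f ≡ sum f
∑≡sum {zero}  f = refl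
∑≡sum {suc n} f = cong (_+_ (f zero)) (∑≡sum (f ∘ suc))

∑-cong : ∀ {n} {f g : Fin n → ℤ} → (∀ i → f i ≡ g i) → ∑ f ≡ ∑ g
∑-cong {zero}  _   = refl
∑-cong {suc n} f≗g = cong₂ _+_ (f≗g zero) (∑-cong (f≗g ∘ suc))

∑-zero : ∀ {n} {f : Fin n → ℤ} → (∀ i → f i ≡ 0ℤ) → ∑ f ≡ 0ℤ
∑-zero {zero}  _   = refl
∑-zero {suc n} f≗0 = cong₂ _+_ (f≗0 zero) (∑-zero (f≗0 ∘ suc))

∑-const : ∀ {n} (x : ℤ) → ∑ {n} (λ _ → x) ≡ + n * x
∑-const {zero}  x = refl
∑-const {suc n} x = trans (cong (_+_ x) (∑-const {n} x)) (sym (ℤₚ.suc-* (+ n) x))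

∑-swap : ∀ {m n} (f : Fin m → Fin n → ℤ) →
         ∑ (λ i → ∑ (f i)) ≡ ∑ (λ j → ∑ (λ i → f i j))
∑-swap f = begin
  ∑ (λ i → ∑ (f i))               ≡⟨ ∑-cong (λ i → ∑≡sum (f i)) ⟩
  ∑ (λ i → sum (f i))             ≡⟨ ∑≡sum (λ i → sum (f i)) ⟩
  sum (λ i → sum (f i))           ≡⟨ sum-comm f ⟩
  sum (λ j → sum (λ i → f i j))   ≡⟨ ∑≡sum (λ j → sum (λ i → f i j)) ⟨
  ∑ (λ j → sum (λ i → f i j))     ≡⟨ ∑-cong (λ j → ∑≡sum (λ i → f i j)) ⟨
  ∑ (λ j → ∑ (λ i → f i j))       ∎
  where open ≡-Reasoning

∑-distribˡ : ∀ {n} (x : ℤ) (f : Fin n → ℤ) → x * ∑ f ≡ ∑ (λ i → x * f i)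
∑-distribˡ {zero}  x f = ℤₚ.*-zeroʳ x
∑-distribˡ {suc n} x f =
  trans (ℤₚ.*-distribˡ-+ x (f zero) _) (cong (_+_ (x * f zero)) (∑-distribˡ x (f ∘ suc)))

∑-distribʳ : ∀ {n} (x : ℤ) (f : Fin n → ℤ) → ∑ f * x ≡ ∑ (λ i → f i * x)
∑-distribʳ x f = begin
  ∑ f * x                ≡⟨ ℤₚ.*-comm (∑ f) x ⟩
  x * ∑ f                ≡⟨ ∑-distribˡ x f ⟩
  ∑ (λ i → x * f i)      ≡⟨ ∑-cong (λ i → ℤₚ.*-comm x (f i)) ⟩
  ∑ (λ i → f i * x)      ∎
  where open ≡-Reasoning

∑-mono : ∀ {n} {f g : Fin n → ℤ} → (∀ i → f i ℤ.≤ g i) → ∑ f ℤ.≤ ∑ g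
∑-mono {zero}  _   = ℤₚ.≤-refl
∑-mono {suc n} f≤g = ℤₚ.+-mono-≤ (f≤g zero) (∑-mono (f≤g ∘ suc))

∑-nonneg : ∀ {n} {f : Fin n → ℤ} → (∀ i → 0ℤ ℤ.≤ f i) → 0ℤ ℤ.≤ ∑ f
∑-nonneg {n} {f} 0≤f = subst (ℤ._≤ ∑ f) (∑-zero {n} {λ _ → 0ℤ} (λ _ → refl)) (∑-mono 0≤f)

∑-term : ∀ {n} {f : Fin n → ℤ} → (∀ i → 0ℤ ℤ.≤ f i) → ∀ i → f i ℤ.≤ ∑ f
∑-term {f = f} 0≤f zero = begin
  f zero                    ≡⟨ ℤₚ.+-identityʳ (f zero) ⟨
  f zero + 0ℤ               ≤⟨ ℤₚ.+-monoʳ-≤ (f zero) (∑-nonneg (0≤f ∘ suc)) ⟩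
  f zero + ∑ (f ∘ suc)      ∎
  where open ℤₚ.≤-Reasoning
∑-term {f = f} 0≤f (suc i) = begin
  f (suc i)                 ≤⟨ ∑-term (0≤f ∘ suc) i ⟩
  ∑ (f ∘ suc)               ≡⟨ ℤₚ.+-identityˡ _ ⟨
  0ℤ + ∑ (f ∘ suc)          ≤⟨ ℤₚ.+-monoˡ-≤ (∑ (f ∘ suc)) (0≤f zero) ⟩
  f zero + ∑ (f ∘ suc)      ∎
  where open ℤₚ.≤-Reasoning

∑-nonneg-zero : ∀ {n} {f : Fin n → ℤ} → (∀ i → 0ℤ ℤ.≤ f i) → ∑ f ≡ 0ℤ → ∀ i → f i ≡ 0ℤ
∑-nonneg-zero 0≤f ∑f≡0 i = ℤₚ.≤-antisym (subst (_ ℤ.≤_) ∑f≡0 (∑-term 0≤f i)) (0≤f i)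

∑-single : ∀ {n} (x : Fin n) (g : Fin n → ℤ) → (∀ l → l ≢ x → g l ≡ 0ℤ) → ∑ g ≡ g x
∑-single zero    g g≡0 =
  trans (cong (_+_ (g zero)) (∑-zero (λ l → g≡0 (suc l) (λ ())))) (ℤₚ.+-identityʳ (g zero))
∑-single (suc x) g g≡0 =
  trans (cong (_+ ∑ (g ∘ suc)) (g≡0 zero (λ ())))
    (trans (ℤₚ.+-identityˡ _) (∑-single x (g ∘ suc) (λ l l≢x → g≡0 (suc l) (l≢x ∘ Finₚ.suc-injective))))

∑-witness : ∀ {n} (f : Fin n → ℤ) → ∑ f ≢ 0ℤ → ∃ λ i → f i ≢ 0ℤ
∑-witness {zero}  f ∑f≢0 = ⊥-elim (∑f≢0 refl)
∑-witness {suc n} f ∑f≢0 with f zero ℤₚ.≟ 0ℤ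
... | no  f0≢0 = zero , f0≢0
... | yes f0≡0 =
  let (i , fi≢0) = ∑-witness (f ∘ suc) (λ rest≡0 → ∑f≢0 (cong₂ _+_ f0≡0 rest≡0))
  in suc i , fi≢0

·-congˡ : ∀ {d} {A A′ : Matrix d} (B : Matrix d) → (∀ i j → A i j ≡ A′ i j) →
          ∀ i j → (A · B) i j ≡ (A′ · B) i j
·-congˡ B A≗A′ i j = ∑-cong (λ l → cong (_* B l j) (A≗A′ i l))

·-congʳ : ∀ {d} (A : Matrix d) {B B′ : Matrix d} → (∀ i j → B i j ≡ B′ i j) →
          ∀ i j → (A · B) i j ≡ (A · B′) i j
·-congʳ A B≗B′ i j = ∑-cong (λ l → cong (A i l *_) (B≗B′ l j))

·-assoc : ∀ {d} (A B C : Matrix d) → ∀ i j → ((A · B) · C) i j ≡ (A · (B · C)) i j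
·-assoc A B C i j = begin
  ∑ (λ l → ∑ (λ m → A i m * B m l) * C l j)
    ≡⟨ ∑-cong (λ l → ∑-distribʳ (C l j) (λ m → A i m * B m l)) ⟩
  ∑ (λ l → ∑ (λ m → A i m * B m l * C l j))        ≡⟨ ∑-swap (λ l m → A i m * B m l * C l j) ⟩
  ∑ (λ m → ∑ (λ l → A i m * B m l * C l j))
    ≡⟨ ∑-cong (λ m → ∑-cong {f = λ l → A i m * B m l * C l j} (λ l → ℤₚ.*-assoc (A i m) (B m l) (C l j))) ⟩
  ∑ (λ m → ∑ (λ l → A i m * (B m l * C l j)))      ≡⟨ ∑-cong (λ m → ∑-distribˡ (A i m) (λ l → B m l * C l j)) ⟨
  ∑ (λ m → A i m * ∑ (λ l → B m l * C l j))        ∎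
  where open ≡-Reasoning

scalarI-diag : ∀ {d} (k : ℤ) (i : Fin d) → scalarI k i i ≡ k
scalarI-diag k i with i ≟ i
... | yes _   = refl
... | no  i≢i = ⊥-elim (i≢i refl)

scalarI-off : ∀ {d} (k : ℤ) (i j : Fin d) → i ≢ j → scalarI k i j ≡ 0ℤ
scalarI-off k i j i≢j with i ≟ j
... | yes i≡j = ⊥-elim (i≢j i≡j)
... | no  _   = refl

scalarI-· : ∀ {d} (k : ℤ) (A : Matrix d) → ∀ i j → (scalarI k · A) i j ≡ k * A i j
scalarI-· k A i j =
  trans (∑-single i _ (λ l l≢i → cong (_* A l j) (scalarI-off k i l (l≢i ∘ sym))))
        (cong (_* A i j) (scalarI-diag k i))

square-nonneg : ∀ x → 0ℤ ℤ.≤ x * x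
square-nonneg (+ zero)   = +≤+ ℕ.z≤n
square-nonneg (+ suc _)  = +≤+ ℕ.z≤n
square-nonneg ℤ.-[1+ _ ] = +≤+ ℕ.z≤n

module WeighingMatrix {d k : ℕ} {W : Matrix d} (weighing : IsWeighing d k W) where

  row-norm : ∀ r → (W · transpose W) r r ≡ + k
  row-norm r = trans (proj₂ weighing r r) (scalarI-diag (+ k) r)

  rows-orthogonal : ∀ r t → r ≢ t → (W · transpose W) r t ≡ 0ℤ
  rows-orthogonal r t r≢t = trans (proj₂ weighing r t) (scalarI-off (+ k) r t r≢t)

  G : Matrix d
  G = transpose W · W

  -- G is symmetric, so (G²) c c is the sum of the squares G c l².
  G-symmetric : ∀ c l → G c l ≡ G l c
  G-symmetric c l = ∑-cong (λ r → ℤₚ.*-comm (W r c) (W r l))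

  -- G² = Wᵀ (W Wᵀ) W = Wᵀ (k I) W = k G.
  G-square : ∀ c l → (G · G) c l ≡ + k * G c l
  G-square c l = begin
    (G · G) c l                                       ≡⟨ ·-assoc (transpose W) W G c l ⟩
    (transpose W · (W · G)) c l
      ≡⟨ ·-congʳ (transpose W) (λ i j → sym (·-assoc W (transpose W) W i j)) c l ⟩
    (transpose W · ((W · transpose W) · W)) c l        ≡⟨ ·-congʳ (transpose W) (·-congˡ W (proj₂ weighing)) c l ⟩
    (transpose W · (scalarI (+ k) · W)) c l            ≡⟨ ·-congʳ (transpose W) (scalarI-· (+ k) W) c l ⟩
    ∑ (λ r → W r c * (+ k * W r l))                    ≡⟨ ∑-cong (λ r → swap-factors (W r c) (+ k) (W r l)) ⟩
    ∑ (λ r → + k * (W r c * W r l))                    ≡⟨ ∑-distribˡ (+ k) (λ r → W r c * W r l) ⟨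
    + k * G c l                                        ∎
    where
    open ≡-Reasoning
    swap-factors : ∀ a b x → a * (b * x) ≡ b * (a * x)
    swap-factors = solve-∀

  column-norm-nonneg : ∀ c → 0ℤ ℤ.≤ G c c
  column-norm-nonneg c = ∑-nonneg (λ r → square-nonneg (W r c))

  -- Every column has squared norm at most k, since G c c² ≤ (G²) c c = k · G c c.
  column-norm-≤ : ∀ c → G c c ℤ.≤ + k
  column-norm-≤ c = cancel (G c c) (column-norm-nonneg c) (begin
    G c c * G c c                  ≤⟨ ∑-term (λ l → square-nonneg (G c l)) c ⟩
    ∑ (λ l → G c l * G c l)        ≡⟨ ∑-cong (λ l → cong (G c l *_) (G-symmetric c l)) ⟩
    (G · G) c c                    ≡⟨ G-square c c ⟩
    + k * G c c                    ∎)
    where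
    open ℤₚ.≤-Reasoning
    cancel : ∀ x → 0ℤ ℤ.≤ x → x * x ℤ.≤ + k * x → x ℤ.≤ + k
    cancel (+ zero)    _ _    = +≤+ ℕ.z≤n
    cancel x@(+ suc _) _ x²≤kx = ℤₚ.*-cancelʳ-≤-pos x (+ k) x x²≤kx

  column-norms-total : ∑ (λ c → G c c) ≡ + d * + k
  column-norms-total = trans (∑-swap (λ c r → W r c * W r c))
                             (trans (∑-cong row-norm) (∑-const {d} (+ k)))

-- In a weighing matrix of positive weight no column vanishes: otherwise the
-- remaining n columns, of squared norm at most k each, could not make up the
-- total (n + 1) · k.
column-nonzero : ∀ {n k} {W : Matrix (suc n)} → IsWeighing (suc n) (suc k) W →
                 ∀ c → ∃ λ r → W r c ≢ 0ℤ
column-nonzero {n} {k} {W} weighing c =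
  let (r , square≢0) = ∑-witness (λ r → W r c * W r c) column≢0
  in r , λ Wrc≡0 → square≢0 (cong (λ y → y * y) Wrc≡0)
  where
  open WeighingMatrix weighing
  N : Fin (suc n) → ℤ
  N c′ = G c′ c′
  bound : ℤ
  bound = + n * + suc k
  others≤ : ∑ (N ∘ punchIn c) ℤ.≤ bound
  others≤ = ℤₚ.≤-trans (∑-mono (column-norm-≤ ∘ punchIn c)) (ℤₚ.≤-reflexive (∑-const {n} (+ suc k)))
  column≢0 : G c c ≢ 0ℤ
  column≢0 Gcc≡0 = ℤₚ.<-irrefl refl (begin-strict
    0ℤ + bound                     <⟨ ℤₚ.+-monoˡ-< bound (ℤ.+<+ (ℕ.s≤s ℕ.z≤n)) ⟩
    + suc k + bound                ≡⟨ ℤₚ.suc-* (+ n) (+ suc k) ⟨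
    + suc n * + suc k              ≡⟨ column-norms-total ⟨
    ∑ N                            ≡⟨ ∑≡sum N ⟩
    sum N                          ≡⟨ sum-remove {i = c} N ⟩
    N c + sum (N ∘ punchIn c)      ≡⟨ cong₂ _+_ Gcc≡0 (sym (∑≡sum (N ∘ punchIn c))) ⟩
    0ℤ + ∑ (N ∘ punchIn c)         ≤⟨ ℤₚ.+-monoʳ-≤ 0ℤ others≤ ⟩
    0ℤ + bound                     ∎)
    where open ℤₚ.≤-Reasoning

-- x is ±1.  Note that Trit x is definitionally x ≡ 0ℤ ⊎ Unit x.
Unit : ℤ → Set
Unit x = (x ≡ 1ℤ) ⊎ (x ≡ -1ℤ)

unit-square : ∀ {a} → Unit a → a * a ≡ 1ℤ
unit-square (inj₁ refl) = refl
unit-square (inj₂ refl) = refl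

unit-abs : ∀ {a} → Unit a → ∣ a ∣ ≡ 1
unit-abs (inj₁ refl) = refl
unit-abs (inj₂ refl) = refl

unit-* : ∀ {a b} → Unit a → Unit b → Unit (a * b)
unit-* (inj₁ refl) (inj₁ refl) = inj₁ refl
unit-* (inj₁ refl) (inj₂ refl) = inj₂ refl
unit-* (inj₂ refl) (inj₁ refl) = inj₂ refl
unit-* (inj₂ refl) (inj₂ refl) = inj₁ refl

unit-abs-* : ∀ {a} → Unit a → ∀ u → ∣ a * u ∣ ≡ ∣ u ∣
unit-abs-* {a} unit u =
  trans (ℤₚ.abs-* a u) (trans (cong (ℕ._* ∣ u ∣) (unit-abs unit)) (ℕₚ.*-identityˡ ∣ u ∣))

trit-nonzero : ∀ {a} → Trit a → a ≢ 0ℤ → Unit a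
trit-nonzero (inj₁ a≡0) a≢0 = ⊥-elim (a≢0 a≡0)
trit-nonzero (inj₂ unit) _  = unit

square-zero : ∀ a → a * a ≡ 0ℤ → a ≡ 0ℤ
square-zero a a²≡0 = [ id , id ]′ (ℤₚ.i*j≡0⇒i≡0∨j≡0 a a²≡0)

-- A sum of two units lies in {0,±2}; if it lies in {0,±1} it is 0.
unit-sum-trit : ∀ {p q} → Unit p → Unit q → Trit (p + q) → p + q ≡ 0ℤ
unit-sum-trit (inj₁ refl) (inj₂ refl) _ = refl
unit-sum-trit (inj₂ refl) (inj₁ refl) _ = refl
unit-sum-trit (inj₁ refl) (inj₁ refl) (inj₁ ())
unit-sum-trit (inj₁ refl) (inj₁ refl) (inj₂ (inj₁ ()))
unit-sum-trit (inj₁ refl) (inj₁ refl) (inj₂ (inj₂ ()))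
unit-sum-trit (inj₂ refl) (inj₂ refl) (inj₁ ())
unit-sum-trit (inj₂ refl) (inj₂ refl) (inj₂ (inj₁ ()))
unit-sum-trit (inj₂ refl) (inj₂ refl) (inj₂ (inj₂ ()))

unit-orthogonal-abs : ∀ {c e u v} → Unit c → Unit e → c * u + e * v ≡ 0ℤ → ∣ u ∣ ≡ ∣ v ∣
unit-orthogonal-abs {c} {e} {u} {v} unit-c unit-e orthogonal = begin
  ∣ u ∣           ≡⟨ unit-abs-* unit-c u ⟨
  ∣ c * u ∣       ≡⟨ cong ∣_∣ (inverseˡ-unique (c * u) (e * v) orthogonal) ⟩
  ∣ - (e * v) ∣   ≡⟨ ℤₚ.∣-i∣≡∣i∣ (e * v) ⟩
  ∣ e * v ∣       ≡⟨ unit-abs-* unit-e v ⟩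
  ∣ v ∣           ∎
  where open ≡-Reasoning

-- A ±1-combination a·u + b·v of entries u, v ∈ {0,±1} with |u| = |v| is 0 or
-- ±2 (an even number), so if it lies in {0,±1} it is 0.
balanced-combination : ∀ {a b u v} → Unit a → Unit b → Trit u → Trit v → ∣ u ∣ ≡ ∣ v ∣ →
                       Trit (a * u + b * v) → a * u + b * v ≡ 0ℤ
balanced-combination {a} {b} _ _ (inj₁ refl) (inj₁ refl) _ _ =
  cong₂ _+_ (ℤₚ.*-zeroʳ a) (ℤₚ.*-zeroʳ b)
balanced-combination _ _ (inj₁ refl) (inj₂ (inj₁ refl)) () _
balanced-combination _ _ (inj₁ refl) (inj₂ (inj₂ refl)) () _
balanced-combination _ _ (inj₂ (inj₁ refl)) (inj₁ refl) () _
balanced-combination _ _ (inj₂ (inj₂ refl)) (inj₁ refl) () _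
balanced-combination unit-a unit-b (inj₂ unit-u) (inj₂ unit-v) _ trit =
  unit-sum-trit (unit-* unit-a unit-u) (unit-* unit-b unit-v) trit

unit-vector : ∀ {n} (g : Fin n → ℤ) → (∀ l → Trit (g l)) → ∑ (λ l → g l * g l) ≡ 1ℤ →
              ∃ λ x → Unit (g x) × (∀ l → l ≢ x → g l ≡ 0ℤ)
unit-vector {zero}  g _ ()
unit-vector {suc n} g trit norm with trit zero
... | inj₂ unit = zero , unit , tail-zero
  where
  tail-norm : ∑ (λ l → g (suc l) * g (suc l)) ≡ 0ℤ
  tail-norm = ∙-cancelˡ 1ℤ _ 0ℤ
    (trans (cong (λ y → y + ∑ (λ l → g (suc l) * g (suc l))) (sym (unit-square unit))) norm)
  tail-zero : ∀ l → l ≢ zero → g l ≡ 0ℤ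
  tail-zero zero    l≢0 = ⊥-elim (l≢0 refl)
  tail-zero (suc l) _   =
    square-zero (g (suc l)) (∑-nonneg-zero (λ l → square-nonneg (g (suc l))) tail-norm l)
... | inj₁ g0≡0 =
  let (x , unit , others-zero) = unit-vector (g ∘ suc) (trit ∘ suc) tail-norm
  in suc x , unit , λ { zero _ → g0≡0 ; (suc l) l≢x → others-zero l (l≢x ∘ cong suc) }
  where
  tail-norm : ∑ (λ l → g (suc l) * g (suc l)) ≡ 1ℤ
  tail-norm = trans (sym (ℤₚ.+-identityˡ _))
    (trans (cong (λ y → y * y + ∑ (λ l → g (suc l) * g (suc l))) (sym g0≡0)) norm)

Anchored : ∀ {n} → Matrix (suc n) → Fin (suc n) → Fin n → Set
Anchored W r x = Unit (W r zero) × Unit (W r (suc x)) × (∀ l → l ≢ x → W r (suc l) ≡ 0ℤ)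

anchored-pairing : ∀ {n} {W : Matrix (suc n)} {r x} → Anchored W r x → (z : Fin (suc n) → ℤ) →
                   ∑ (λ l → W r l * z l) ≡ W r zero * z zero + W r (suc x) * z (suc x)
anchored-pairing {W = W} {r} {x} (_ , _ , zeros) z =
  cong (_+_ (W r zero * z zero))
       (∑-single x (λ l → W r (suc l) * z (suc l)) (λ l l≢x → cong (_* z (suc l)) (zeros l l≢x)))

weight-two-row : ∀ {n} {W : Matrix (suc n)} → IsWeighing (suc n) 2 W →
                 ∀ r → Unit (W r zero) → ∃ λ x → Anchored W r x
weight-two-row {W = W} weighing r unit0 =
  let (x , unitx , zeros) = unit-vector (λ l → W r (suc l)) (λ l → proj₁ weighing r (suc l)) tail-norm
  in x , unit0 , unitx , zeros
  where
  open WeighingMatrix weighing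
  tail-norm : ∑ (λ l → W r (suc l) * W r (suc l)) ≡ 1ℤ
  tail-norm = ∙-cancelˡ 1ℤ _ 1ℤ
    (trans (cong (λ y → y + ∑ (λ l → W r (suc l) * W r (suc l))) (sym (unit-square unit0))) (row-norm r))

-- Every weighing matrix of weight 2 has an anchored row (column 0 is nonzero).
weight-two-anchor : ∀ {n} {W : Matrix (suc n)} → IsWeighing (suc n) 2 W → ∃₂ λ r x → Anchored W r x
weight-two-anchor weighing =
  let (r , Wr0≢0) = column-nonzero weighing zero
      (x , anchored) = weight-two-row weighing r (trit-nonzero (proj₁ weighing r zero) Wr0≢0)
  in r , x , anchored

-- If row r of a weighing matrix is anchored at x, then columns 0 and suc x agree
-- in absolute value in every row t (for t ≠ r by orthogonality to row r).
anchored-columns-balanced : ∀ {n k} {W : Matrix (suc n)} {r x} → IsWeighing (suc n) k W →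
                            Anchored W r x → ∀ t → ∣ W t zero ∣ ≡ ∣ W t (suc x) ∣
anchored-columns-balanced {W = W} {r} weighing anchored@(unit0 , unitx , _) t with r ≟ t
... | yes refl = trans (unit-abs unit0) (sym (unit-abs unitx))
... | no  r≢t  = unit-orthogonal-abs unit0 unitx
                   (trans (sym (anchored-pairing {W = W} anchored (W t))) (rows-orthogonal r t r≢t))
  where open WeighingMatrix weighing

-- If rows of A and of B (B of weight 2) are anchored at the same x, the
-- corresponding row of A Bᵀ vanishes, so A Bᵀ is no weighing matrix of positive weight.
shared-anchor-impossible : ∀ {n l} {A B : Matrix (suc n)} {rᵢ rⱼ x} →
  IsWeighing (suc n) 2 B → IsWeighing (suc n) (suc l) (A · transpose B) →
  Anchored A rᵢ x → Anchored B rⱼ x → ⊥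
shared-anchor-impossible {l = l} {A} {B} {rᵢ} {x = x}
                         weighingB weighingP anchoredA@(unit-a , unit-b , _) anchoredB =
  weight≢0 (trans (sym (row-norm rᵢ)) (∑-zero (λ t → cong (λ y → y * y) (row-vanishes t))))
  where
  open WeighingMatrix weighingP
  row-vanishes : ∀ t → (A · transpose B) rᵢ t ≡ 0ℤ
  row-vanishes t = trans pairing (balanced-combination unit-a unit-b
    (proj₁ weighingB t zero) (proj₁ weighingB t (suc x))
    (anchored-columns-balanced {W = B} weighingB anchoredB t) (subst Trit pairing (proj₁ weighingP rᵢ t)))
    where
    pairing : (A · transpose B) rᵢ t ≡ A rᵢ zero * B t zero + A rᵢ (suc x) * B t (suc x)
    pairing = anchored-pairing {W = A} anchoredA (B t)
  -- Row rᵢ of A Bᵀ has squared norm l + 1, yet all its entries vanish.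
  weight≢0 : + suc l ≢ 0ℤ
  weight≢0 ()

-- Each Wᵢ has a row anchored at some xᵢ ∈ Fin (d − 1), and i ↦ xᵢ is injective.
theorem5p1 : (d f : ℕ) → 1 ≤ d → (W : Fin f → Matrix d) →
    (∀ i → IsWeighing d 2 (W i)) →
    (∀ i j → i ≢ j → QuasiUnbiased₁ d 2 4 (W i) (W j)) →
    f ≤ d ∸ 1
theorem5p1 zero    f () W weighing quasiUnbiased
theorem5p1 (suc n) f _  W weighing quasiUnbiased = Finₚ.injective⇒≤ {f = anchor-column} anchor-injective
  where
  anchor : ∀ i → ∃₂ λ r x → Anchored (W i) r x
  anchor i = weight-two-anchor {W = W i} (weighing i)
  anchor-row : Fin f → Fin (suc n)
  anchor-row i = proj₁ (anchor i)
  anchor-column : Fin f → Fin n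
  anchor-column i = proj₁ (proj₂ (anchor i))
  anchored : ∀ i → Anchored (W i) (anchor-row i) (anchor-column i)
  anchored i = proj₂ (proj₂ (anchor i))
  anchor-injective : Injective _≡_ _≡_ anchor-column
  -- i ≡ j is decidable, and i ≢ j would give two rows anchored at the same column.
  anchor-injective {i} {j} same = decidable-stable (i ≟ j) λ i≢j →
    shared-anchor-impossible {A = W i} {B = W j}
      (weighing j) (proj₂ (proj₂ (quasiUnbiased i j i≢j)))
      (anchored i) (subst (Anchored (W j) (anchor-row j)) (sym same) (anchored j))
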